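{- An automorphism $x\in\Omega$ lies in $U$ if and only if $(x,x^{ -1})\in G$.
   Context: Let $T$ be the infinite regular rooted binary tree (vertices: finite words over $\{1,2\}$) and $\Omega=\mathrm{Aut}(T)$ with the profinite topology. Write elements of $\Omega$ as $(u,v)\tau$ with $u,v\in\Omega$ (actions on the two subtrees at level 1) and $\tau\in\{\mathrm{id},\sigma\}$, $\sigma=(\mathrm{id},\mathrm{id})\sigma$ the swap; $(u,v)$ denotes $(u,v)\mathrm{id}$; multiplication: $(x_1,x_2)\tau(y_1,y_2)\tau'=(x_1y_{\tau(1)},x_2y_{\tau(2)})\tau\tau'$. Let $a_1,a_2,a_3\in\Omega$ be the unique elements with $a_1=\sigma$, $a_2=(a_3^{ -1},a_2^{ -1})\sigma$, $a_3=(a_2,a_3)$. Let $G$ be the closed subgroup topologically generated by $a_1,a_2,a_3$, and let $U$ be the closed normal subgroup of $G$ generated by $a_2a_3^{ -1}$. -}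

module Defs where

open import Data.Bool using (Bool; true; false; _xor_)
open import Data.List using (List; []; _∷_; length; foldr)
open import Data.Nat using (ℕ; _<_)
open import Data.Fin using (Fin; zero; suc)
open import Data.Product using (_×_; _,_; ∃-syntax)
open import Relation.Binary.PropositionalEquality using (_≡_)

-- Vertices of the binary rooted tree T: finite words over {1,2};
-- letter 1 is encoded as false, letter 2 as true.
Vertex : Set
Vertex = List Bool

-- An automorphism of T (element of Ω) is represented by its portrait:
-- the label at vertex v is true iff the automorphism swaps the two
-- children of v (i.e. the root label of its section at v is σ).
-- Portraits are in bijection with Aut(T); equality is pointwise.
Aut : Set
Aut = Vertex → Bool

-- root label τ and sections (x = (sec x false , sec x true) τ)
root : Aut → Bool
root x = x []

sec : Aut → Bool → Aut
sec x b w = x (b ∷ w)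

node : Aut → Aut → Bool → Aut
node u v τ []          = τ
node u v τ (false ∷ w) = u w
node u v τ (true ∷ w)  = v w

e : Aut
e _ = false

-- multiplication, following (x1,x2)τ (y1,y2)τ' = (x1 y_{τ(1)}, x2 y_{τ(2)}) ττ'
_·_ : Aut → Aut → Aut
(x · y) []      = x [] xor y []
(x · y) (b ∷ w) = (sec x b · sec y (b xor x [])) w

infixl 7 _·_

-- inverse: (x1,x2)τ ⁻¹ = ((x_{τ⁻¹(1)})⁻¹ , (x_{τ⁻¹(2)})⁻¹) τ⁻¹
inv : Aut → Aut
inv x []      = x []
inv x (b ∷ w) = inv (sec x (b xor x [])) w

-- These are the basic neighbourhoods of the profinite topology.
Agree : ℕ → Aut → Aut → Set
Agree n x y = (w : Vertex) → length w < n → x w ≡ y w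

-- The generators: a1 = σ, a2 = (a3⁻¹, a2⁻¹)σ, a3 = (a2, a3).
-- Defined mutually with their inverses a2⁻¹ = (a2, a3)σ, a3⁻¹ = (a2⁻¹, a3⁻¹);
-- these recursions have unique solutions.
a1 : Aut
a1 = node e e true

a2 a2⁻ a3 a3⁻ : Aut
a2 []          = true
a2 (false ∷ w) = a3⁻ w
a2 (true ∷ w)  = a2⁻ w
a2⁻ []          = true
a2⁻ (false ∷ w) = a2 w
a2⁻ (true ∷ w)  = a3 w
a3 []          = false
a3 (false ∷ w) = a2 w
a3 (true ∷ w)  = a3 w
a3⁻ []          = false
a3⁻ (false ∷ w) = a2⁻ w
a3⁻ (true ∷ w)  = a3⁻ w

gen : Fin 3 → Aut
gen zero             = a1
gen (suc zero)       = a2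
gen (suc (suc zero)) = a3

sgen : Fin 3 × Bool → Aut
sgen (i , false) = gen i
sgen (i , true)  = inv (gen i)

evalWord : List (Fin 3 × Bool) → Aut
evalWord = foldr (λ s acc → sgen s · acc) e

-- G = closure of ⟨a1,a2,a3⟩ in the profinite topology
InG : Aut → Set
InG x = (n : ℕ) → ∃[ w ] Agree n (evalWord w) x

c : Aut
c = a2 · inv a3

cpow : Bool → Aut
cpow false = c
cpow true  = inv c

-- The (abstract) normal subgroup of G generated by c: finite products of
-- G-conjugates g c^{±1} g⁻¹ with g ∈ G.
data InNC : Aut → Set where
  nc-e    : InNC e
  nc-step : ∀ {g p} → InG g → (s : Bool) → InNC p →
            InNC ((g · cpow s · inv g) · p)

-- U = closed normal subgroup of G generated by c = closure of InNC
InU : Aut → Set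
InU x = (n : ℕ) → ∃[ p ] (InNC p × Agree n p x)

pair : Aut → Aut → Aut
pair x y = node x y false

{-# OPTIONS --safe #-}
module Submission where

-- Write Γ = ⟨a₁, a₂, a₃⟩, c = a₂a₃⁻¹ and d = a₂ca₂⁻¹. The subgroup V = ⟨c, d⟩ is abelian, the
-- generators of Γ normalise it, and (v, v⁻¹) ∈ Γ for v = c, d; hence P = {(v, v⁻¹) : v ∈ V} is a
-- subgroup of Γ.
-- If x ∈ U, approximate x by products of G-conjugates of c^{±1}, and these by Γ-conjugates, which
-- lie in V; then (x, x⁻¹) is approximated by elements of P ⊆ Γ.
-- Conversely Γ = T·P for the eight elements T = {c^ε a₂^k}. If t·(v, v⁻¹) agrees with (x, x⁻¹) on
-- three levels then t = 1: modulo level 2 the element v is one of four, and for each of them and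
-- each t ≠ 1 either t swaps at the root or the two first-level sections of t·(v, v⁻¹) are not
-- mutually inverse modulo level 2. So deep approximations of (x, x⁻¹) in Γ are elements (v, v⁻¹),
-- and v, a product of conjugates of c^{±1}, approximates x.
-- Identities between words in the generators are verified by computing a finite bisimulation
-- between their portraits: the sections of a word are again words, and free reduction keeps them few.

open import Defs
open import Algebra.Bundles using (Group)
import Algebra.Properties.Group as GroupProperties
open import Data.Bool as Bool using (Bool; true; false; not; _xor_; if_then_else_)
open import Data.Bool.Properties using (xor-assoc; xor-identityʳ; xor-same)
open import Data.Empty using (⊥-elim)
open import Data.Fin using (Fin; zero; suc; toℕ)
open import Data.Fin.Properties as Fin using (all?)
open import Data.List
  using (List; []; _∷_; _++_; _∷ʳ_; length; map; reverse; foldr; replicate; concatMap; allFin;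
         cartesianProduct; cartesianProductWith)
import Data.List.Properties as List
import Data.List.Membership.DecPropositional as DecMembership
open import Data.List.Relation.Unary.All as All using (All)
open import Data.List.Relation.Unary.Any as Any using (Any)
open import Data.Nat using (ℕ; zero; suc; _+_; _≤_; s≤s; z≤n)
open import Data.Nat.DivMod using (_mod_)
open import Data.Nat.Properties using (≤-trans; ≤-refl; m≤m+n; m≤n+m)
open import Data.Product using (_×_; _,_; proj₁; proj₂; ∃-syntax; uncurry; curry)
import Data.Product.Properties as Product
open import Data.Sum using (_⊎_; inj₁; inj₂)
open import Function using (_∘_; id)
open import Function.Bundles using (_⇔_; mk⇔)
open import Level using (0ℓ)
open import Relation.Binary.Bundles using (Setoid)
open import Relation.Binary.Definitions using (DecidableEquality)
open import Relation.Binary.PropositionalEquality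
open import Relation.Nullary using (Dec; yes; no; ¬_)
open import Relation.Nullary.Decidable using (map′; _×-dec_; _⊎-dec_; ¬?; from-yes)
open import Relation.Unary using (Decidable)
import Relation.Binary.Reasoning.Setoid as SetoidReasoning

private variable
  n   : ℕ
  A B : Set
  g g′ x x′ y y′ z : Aut

-- The group Ω and agreement on the first n levels

xor-cancelʳ : ∀ a b → (a xor b) xor b ≡ a
xor-cancelʳ a b = trans (xor-assoc a b b) (trans (cong (a xor_) (xor-same b)) (xor-identityʳ a))

Agree-refl : Agree n x x
Agree-refl _ _ = refl

Agree-sym : Agree n x y → Agree n y x
Agree-sym p w l = sym (p w l)

Agree-trans : Agree n x y → Agree n y z → Agree n x z
Agree-trans p q w l = trans (p w l) (q w l)

Agree-mono : ∀ {m} → m ≤ n → Agree n x y → Agree m x y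
Agree-mono m≤n p w l = p w (≤-trans l m≤n)

≗⇒Agree : x ≗ y → Agree n x y
≗⇒Agree p w _ = p w

Agree-root : Agree (suc n) x y → root x ≡ root y
Agree-root p = p [] (s≤s z≤n)

Agree-sec : Agree (suc n) x y → ∀ b → Agree n (sec x b) (sec y b)
Agree-sec p b w l = p (b ∷ w) (s≤s l)

Agree-· : ∀ n {x x′ y y′} → Agree n x x′ → Agree n y y′ → Agree n (x · y) (x′ · y′)
Agree-· zero    p q w ()
Agree-· (suc n) p q [] l = cong₂ _xor_ (Agree-root p) (Agree-root q)
Agree-· (suc n) {x′ = x′} p q (b ∷ w) (s≤s l) rewrite Agree-root p =
  Agree-· n (Agree-sec p b) (Agree-sec q (b xor root x′)) w l

Agree-inv : ∀ n {x x′} → Agree n x x′ → Agree n (inv x) (inv x′)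
Agree-inv zero    p w ()
Agree-inv (suc n) p [] l = Agree-root p
Agree-inv (suc n) {x′ = x′} p (b ∷ w) (s≤s l) rewrite Agree-root p =
  Agree-inv n (Agree-sec p (b xor root x′)) w l

Agree-pair : Agree n x x′ → Agree n y y′ → Agree (suc n) (pair x y) (pair x′ y′)
Agree-pair p q []          _       = refl
Agree-pair p q (false ∷ w) (s≤s l) = p w l
Agree-pair p q (true ∷ w)  (s≤s l) = q w l

Agree? : ∀ n x y → Dec (Agree n x y)
Agree? zero    x y = yes λ _ ()
Agree? (suc n) x y =
  map′ fromLevels (λ p → Agree-root p , Agree-sec p false , Agree-sec p true)
    ((root x Bool.≟ root y) ×-dec Agree? n (sec x false) (sec y false) ×-dec Agree? n (sec x true) (sec y true))
  where
  fromLevels : root x ≡ root y × Agree n (sec x false) (sec y false) × Agree n (sec x true) (sec y true) →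
               Agree (suc n) x y
  fromLevels (r , _ , _) []          _       = r
  fromLevels (_ , f , _) (false ∷ w) (s≤s l) = f w l
  fromLevels (_ , _ , t) (true ∷ w)  (s≤s l) = t w l

≗-by-levels : (∀ n → Agree n x y) → x ≗ y
≗-by-levels p w = p (suc (length w)) w (s≤s ≤-refl)

·-cong : x ≗ x′ → y ≗ y′ → x · y ≗ x′ · y′
·-cong p q = ≗-by-levels λ n → Agree-· n (≗⇒Agree p) (≗⇒Agree q)

inv-cong : x ≗ x′ → inv x ≗ inv x′
inv-cong p = ≗-by-levels λ n → Agree-inv n (≗⇒Agree p)

·-assoc : ∀ x y z → (x · y) · z ≗ x · (y · z)
·-assoc x y z []      = xor-assoc (root x) (root y) (root z)
·-assoc x y z (b ∷ w) =
  trans (cong (λ t → ((sec x b · sec y (b xor root x)) · sec z t) w) (sym (xor-assoc b (root x) (root y))))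
        (·-assoc (sec x b) (sec y (b xor root x)) (sec z ((b xor root x) xor root y)) w)

·-identityˡ : ∀ x → e · x ≗ x
·-identityˡ x []      = refl
·-identityˡ x (b ∷ w) = trans (cong (λ t → (e · sec x t) w) (xor-identityʳ b)) (·-identityˡ (sec x b) w)

·-identityʳ : ∀ x → x · e ≗ x
·-identityʳ x []      = xor-identityʳ (root x)
·-identityʳ x (b ∷ w) = ·-identityʳ (sec x b) w

·-inverseˡ : ∀ x → inv x · x ≗ e
·-inverseˡ x []      = xor-same (root x)
·-inverseˡ x (b ∷ w) = ·-inverseˡ (sec x (b xor root x)) w

·-inverseʳ : ∀ x → x · inv x ≗ e
·-inverseʳ x []      = xor-same (root x)
·-inverseʳ x (b ∷ w) =
  trans (cong (λ t → (sec x b · inv (sec x t)) w) (xor-cancelʳ b (root x))) (·-inverseʳ (sec x b) w)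

Ω : Group 0ℓ 0ℓ
Ω = record
  { Carrier = Aut ; _≈_ = _≗_ ; _∙_ = _·_ ; ε = e ; _⁻¹ = inv
  ; isGroup = record
    { isMonoid = record
      { isSemigroup = record
        { isMagma = record { isEquivalence = Setoid.isEquivalence (Vertex →-setoid Bool) ; ∙-cong = ·-cong }
        ; assoc = ·-assoc }
      ; identity = ·-identityˡ , ·-identityʳ }
    ; inverse = ·-inverseˡ , ·-inverseʳ
    ; ⁻¹-cong = inv-cong } }

open Group Ω using () renaming (sym to ≗-sym; trans to ≗-trans)
open GroupProperties Ω using (inverseʳ-unique; ⁻¹-involutive; ⁻¹-anti-homo-∙; ε⁻¹≈ε)
open SetoidReasoning (Group.setoid Ω)

conj : Aut → Aut → Aut
conj g x = g · x · inv g

Agree-conj : ∀ n {g g′ x x′} → Agree n g g′ → Agree n x x′ → Agree n (conj g x) (conj g′ x′)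
Agree-conj n p q = Agree-· n (Agree-· n p q) (Agree-inv n p)

conj-congˡ : g ≗ g′ → conj g x ≗ conj g′ x
conj-congˡ p = ·-cong (·-cong p (λ _ → refl)) (inv-cong p)

conj-congʳ : x ≗ x′ → conj g x ≗ conj g x′
conj-congʳ p = ·-cong (·-cong (λ _ → refl) p) (λ _ → refl)

conj-identity : ∀ x → conj e x ≗ x
conj-identity x = begin
  (e · x) · inv e ≈⟨ ·-cong (·-identityˡ x) ε⁻¹≈ε ⟩
  x · e           ≈⟨ ·-identityʳ x ⟩
  x               ∎

conj-· : ∀ g h x → conj (g · h) x ≗ conj g (conj h x)
conj-· g h x = begin
  ((g · h) · x) · inv (g · h)     ≈⟨ ·-cong (·-assoc g h x) (⁻¹-anti-homo-∙ g h) ⟩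
  (g · (h · x)) · (inv h · inv g) ≈⟨ ≗-sym (·-assoc (g · (h · x)) (inv h) (inv g)) ⟩
  ((g · (h · x)) · inv h) · inv g ≈⟨ ·-cong (·-assoc g (h · x) (inv h)) (λ _ → refl) ⟩
  (g · ((h · x) · inv h)) · inv g ∎

pair-cong : x ≗ x′ → y ≗ y′ → pair x y ≗ pair x′ y′
pair-cong p q []          = refl
pair-cong p q (false ∷ w) = p w
pair-cong p q (true ∷ w)  = q w

pair-· : ∀ x y x′ y′ → pair x y · pair x′ y′ ≗ pair (x · x′) (y · y′)
pair-· x y x′ y′ []          = refl
pair-· x y x′ y′ (false ∷ w) = refl
pair-· x y x′ y′ (true ∷ w)  = refl

≗-pair-sec : root x ≡ false → x ≗ pair (sec x false) (sec x true)
≗-pair-sec r []          = r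
≗-pair-sec r (false ∷ w) = refl
≗-pair-sec r (true ∷ w)  = refl

e≗pair-e : e ≗ pair e (inv e)
e≗pair-e = ≗-trans (≗-pair-sec refl) (pair-cong (λ _ → refl) (≗-sym ε⁻¹≈ε))

commute-· : x · y ≗ y · x → x · z ≗ z · x → x · (y · z) ≗ (y · z) · x
commute-· {x} {y} {z} xy≗yx xz≗zx = begin
  x · (y · z) ≈⟨ ≗-sym (·-assoc x y z) ⟩
  (x · y) · z ≈⟨ ·-cong xy≗yx (λ _ → refl) ⟩
  (y · x) · z ≈⟨ ·-assoc y x z ⟩
  y · (x · z) ≈⟨ ·-cong (λ _ → refl) xz≗zx ⟩
  y · (z · x) ≈⟨ ≗-sym (·-assoc y z x) ⟩
  (y · z) · x ∎

pair-diagonal-· : x · y ≗ y · x → pair x (inv x) · pair y (inv y) ≗ pair (x · y) (inv (x · y))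
pair-diagonal-· {x} {y} xy≗yx = begin
  pair x (inv x) · pair y (inv y) ≈⟨ pair-· x (inv x) y (inv y) ⟩
  pair (x · y) (inv x · inv y)    ≈⟨ pair-cong (λ _ → refl) (begin
    inv x · inv y                   ≈⟨ ≗-sym (⁻¹-anti-homo-∙ y x) ⟩
    inv (y · x)                     ≈⟨ inv-cong (≗-sym xy≗yx) ⟩
    inv (x · y)                     ∎) ⟩
  pair (x · y) (inv (x · y))      ∎

pair-inverse-sections : Agree (suc n) g (pair x (inv x)) → Agree n (sec g false · sec g true) e
pair-inverse-sections {n} p =
  Agree-trans (Agree-· n (Agree-sec p false) (Agree-sec p true)) (≗⇒Agree (·-inverseʳ _))

Separated : Aut → Set
Separated g = root g ≡ true ⊎ ¬ Agree 2 (sec g false · sec g true) e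

separated? : ∀ g → Dec (Separated g)
separated? g = (root g Bool.≟ true) ⊎-dec ¬? (Agree? 2 (sec g false · sec g true) e)

Separated⇒¬Agree : Separated g → ¬ Agree 3 g (pair x (inv x))
Separated⇒¬Agree (inj₁ root≡true) p with () ← trans (sym root≡true) (Agree-root p)
Separated⇒¬Agree (inj₂ ¬trivial)  p = ¬trivial (pair-inverse-sections p)

Exhaustible : Set → Set₁
Exhaustible A = ∀ {P : A → Set} → Decidable P → Dec (∀ a → P a)

Bool-exhaustible : Exhaustible Bool
Bool-exhaustible {P} P? = map′ both (λ h → h false , h true) (P? false ×-dec P? true)
  where
  both : P false × P true → ∀ b → P b
  both (p , _) false = p
  both (_ , q) true  = q

×-exhaustible : Exhaustible A → Exhaustible B → Exhaustible (A × B)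
×-exhaustible ∀A? ∀B? P? = map′ uncurry curry (∀A? λ a → ∀B? λ b → P? (a , b))

-- Words in the generators

mutual
  a2·a2⁻≗e : a2 · a2⁻ ≗ e
  a2·a2⁻≗e []          = refl
  a2·a2⁻≗e (false ∷ w) = a3⁻·a3≗e w
  a2·a2⁻≗e (true ∷ w)  = a2⁻·a2≗e w

  a2⁻·a2≗e : a2⁻ · a2 ≗ e
  a2⁻·a2≗e []          = refl
  a2⁻·a2≗e (false ∷ w) = a2·a2⁻≗e w
  a2⁻·a2≗e (true ∷ w)  = a3·a3⁻≗e w

  a3·a3⁻≗e : a3 · a3⁻ ≗ e
  a3·a3⁻≗e []          = refl
  a3·a3⁻≗e (false ∷ w) = a2·a2⁻≗e w
  a3·a3⁻≗e (true ∷ w)  = a3·a3⁻≗e w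

  a3⁻·a3≗e : a3⁻ · a3 ≗ e
  a3⁻·a3≗e []          = refl
  a3⁻·a3≗e (false ∷ w) = a2⁻·a2≗e w
  a3⁻·a3≗e (true ∷ w)  = a3⁻·a3≗e w

a2⁻≗a2⁻¹ : a2⁻ ≗ inv a2
a2⁻≗a2⁻¹ = inverseʳ-unique a2 a2⁻ a2·a2⁻≗e

a3⁻≗a3⁻¹ : a3⁻ ≗ inv a3
a3⁻≗a3⁻¹ = inverseʳ-unique a3 a3⁻ a3·a3⁻≗e

Letter : Set
Letter = Fin 3 × Bool

Word : Set
Word = List Letter

pattern A₁  = (zero , false)
pattern A₂  = (suc zero , false)
pattern A₂⁻ = (suc zero , true)
pattern A₃  = (suc (suc zero) , false)
pattern A₃⁻ = (suc (suc zero) , true)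

Letter-exhaustible : Exhaustible Letter
Letter-exhaustible = ×-exhaustible all? Bool-exhaustible

_≟_ : DecidableEquality Letter
_≟_ = Product.≡-dec Fin._≟_ Bool._≟_

inverse : Letter → Letter
inverse (i , s) = i , not s

wordInverse : Word → Word
wordInverse u = reverse (map inverse u)

evalWord∈G : ∀ u → InG (evalWord u)
evalWord∈G u n = u , Agree-refl

evalWord-++ : ∀ u v → evalWord (u ++ v) ≗ evalWord u · evalWord v
evalWord-++ []      v = ≗-sym (·-identityˡ (evalWord v))
evalWord-++ (l ∷ u) v = begin
  sgen l · evalWord (u ++ v)         ≈⟨ ·-cong (λ _ → refl) (evalWord-++ u v) ⟩
  sgen l · (evalWord u · evalWord v) ≈⟨ ≗-sym (·-assoc (sgen l) (evalWord u) (evalWord v)) ⟩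
  (sgen l · evalWord u) · evalWord v ∎

evalWord-[_] : ∀ l → evalWord (l ∷ []) ≗ sgen l
evalWord-[ l ] = ·-identityʳ (sgen l)

sgen-inverse : ∀ l → sgen (inverse l) ≗ inv (sgen l)
sgen-inverse (i , false) = λ _ → refl
sgen-inverse (i , true)  = ≗-sym (⁻¹-involutive (gen i))

evalWord-wordInverse : ∀ u → evalWord (wordInverse u) ≗ inv (evalWord u)
evalWord-wordInverse []      = ≗-sym ε⁻¹≈ε
evalWord-wordInverse (l ∷ u) = begin
  evalWord (reverse (inverse l ∷ map inverse u))
    ≡⟨ cong evalWord (List.unfold-reverse (inverse l) (map inverse u)) ⟩
  evalWord (wordInverse u ∷ʳ inverse l)
    ≈⟨ evalWord-++ (wordInverse u) (inverse l ∷ []) ⟩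
  evalWord (wordInverse u) · evalWord (inverse l ∷ [])
    ≈⟨ ·-cong (evalWord-wordInverse u) (≗-trans evalWord-[ inverse l ] (sgen-inverse l)) ⟩
  inv (evalWord u) · inv (sgen l)
    ≈⟨ ≗-sym (⁻¹-anti-homo-∙ (sgen l) (evalWord u)) ⟩
  inv (sgen l · evalWord u) ∎

generatorSection : Fin 3 → Bool → Word
generatorSection zero             _     = []
generatorSection (suc zero)       false = A₃⁻ ∷ []
generatorSection (suc zero)       true  = A₂⁻ ∷ []
generatorSection (suc (suc zero)) false = A₂ ∷ []
generatorSection (suc (suc zero)) true  = A₃ ∷ []

letterSection : Letter → Bool → Word
letterSection (i , false) b = generatorSection i b
letterSection (i , true)  b = wordInverse (generatorSection i (b xor root (gen i)))

section : Word → Bool → Word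
section []      b = []
section (l ∷ u) b = letterSection l b ++ section u (b xor root (sgen l))

sec-gen : ∀ i b → sec (gen i) b ≗ evalWord (generatorSection i b)
sec-gen zero             false = λ _ → refl
sec-gen zero             true  = λ _ → refl
sec-gen (suc zero)       false = ≗-trans a3⁻≗a3⁻¹ (≗-sym evalWord-[ A₃⁻ ])
sec-gen (suc zero)       true  = ≗-trans a2⁻≗a2⁻¹ (≗-sym evalWord-[ A₂⁻ ])
sec-gen (suc (suc zero)) false = ≗-sym evalWord-[ A₂ ]
sec-gen (suc (suc zero)) true  = ≗-sym evalWord-[ A₃ ]

sec-sgen : ∀ l b → sec (sgen l) b ≗ evalWord (letterSection l b)
sec-sgen (i , false) b = sec-gen i b
sec-sgen (i , true)  b = begin
  inv (sec (gen i) b′)                   ≈⟨ inv-cong (sec-gen i b′) ⟩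
  inv (evalWord (generatorSection i b′)) ≈⟨ ≗-sym (evalWord-wordInverse (generatorSection i b′)) ⟩
  evalWord (letterSection (i , true) b)  ∎
  where b′ = b xor root (gen i)

sec-evalWord : ∀ u b → sec (evalWord u) b ≗ evalWord (section u b)
sec-evalWord []      b = λ _ → refl
sec-evalWord (l ∷ u) b = begin
  sec (sgen l) b · sec (evalWord u) b′                   ≈⟨ ·-cong (sec-sgen l b) (sec-evalWord u b′) ⟩
  evalWord (letterSection l b) · evalWord (section u b′) ≈⟨ ≗-sym (evalWord-++ (letterSection l b) (section u b′)) ⟩
  evalWord (letterSection l b ++ section u b′)           ∎
  where b′ = b xor root (sgen l)

push : Letter → Word → Word
push l []      = l ∷ []
push l (m ∷ u) with m ≟ inverse l
... | yes _ = u
... | no  _ = l ∷ m ∷ u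

evalWord-push : ∀ l u → evalWord (push l u) ≗ sgen l · evalWord u
evalWord-push l []      = λ _ → refl
evalWord-push l (m ∷ u) with m ≟ inverse l
... | no  _    = λ _ → refl
... | yes refl = begin
  evalWord u                               ≈⟨ ≗-sym (·-identityˡ (evalWord u)) ⟩
  e · evalWord u                           ≈⟨ ·-cong (≗-sym l·l⁻¹≗e) (λ _ → refl) ⟩
  (sgen l · sgen (inverse l)) · evalWord u ≈⟨ ·-assoc (sgen l) (sgen (inverse l)) (evalWord u) ⟩
  sgen l · evalWord (inverse l ∷ u)        ∎
  where
  l·l⁻¹≗e : sgen l · sgen (inverse l) ≗ e
  l·l⁻¹≗e = ≗-trans (·-cong (λ _ → refl) (sgen-inverse l)) (·-inverseʳ (sgen l))

reduce : Word → Word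
reduce = foldr push []

evalWord-reduce : ∀ u → evalWord (reduce u) ≗ evalWord u
evalWord-reduce []      = λ _ → refl
evalWord-reduce (l ∷ u) = ≗-trans (evalWord-push l (reduce u)) (·-cong (λ _ → refl) (evalWord-reduce u))

-- Deciding equality of words by bisimulation

WordPair : Set
WordPair = Word × Word

open DecMembership (Product.≡-dec (List.≡-dec _≟_) (List.≡-dec _≟_)) using (_∈_; _∈?_)

successor : WordPair → Bool → WordPair
successor (u , v) b = reduce (section u b) , reduce (section v b)

Consistent : List WordPair → WordPair → Set
Consistent R (u , v) = root (evalWord u) ≡ root (evalWord v) × (∀ b → successor (u , v) b ∈ R)

IsBisimulation : List WordPair → Set
IsBisimulation R = All (Consistent R) R

bisimulation-sound : ∀ {R u v} → IsBisimulation R → (u , v) ∈ R → evalWord u ≗ evalWord v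
bisimulation-sound B uv∈R [] = proj₁ (All.lookup B uv∈R)
bisimulation-sound {u = u} {v} B uv∈R (b ∷ w) =
  trans (sec-evalWord u b w)
  (trans (sym (evalWord-reduce (section u b) w))
  (trans (bisimulation-sound B (proj₂ (All.lookup B uv∈R) b) w)
  (trans (evalWord-reduce (section v b) w)
         (sym (sec-evalWord v b w)))))

-- `explore` only proposes a candidate relation (breadth first, stopping at the first root
-- mismatch); soundness rests on `isBisimulation?` alone.
explore : ℕ → List WordPair → List WordPair → List WordPair
explore zero    _          seen = seen
explore (suc k) []         seen = seen
explore (suc k) (p ∷ todo) seen with p ∈? seen
... | yes _ = explore k todo seen
... | no  _ with root (evalWord (proj₁ p)) Bool.≟ root (evalWord (proj₂ p))
...   | no  _ = p ∷ seen
...   | yes _ = explore k (todo ++ successor p false ∷ successor p true ∷ []) (p ∷ seen)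

candidate : Word → Word → List WordPair
candidate u v = explore 2000 ((reduce u , reduce v) ∷ []) []

isBisimulation? : ∀ R → Dec (IsBisimulation R)
isBisimulation? R = All.all? consistent? R
  where
  consistent? : Decidable (Consistent R)
  consistent? (u , v) =
    (root (evalWord u) Bool.≟ root (evalWord v)) ×-dec Bool-exhaustible (λ b → successor (u , v) b ∈? R)

record Certifies (R : List WordPair) (u v : Word) : Set where
  constructor certified
  field
    isBisimulation : IsBisimulation R
    contains       : (reduce u , reduce v) ∈ R

certifies? : ∀ R u v → Dec (Certifies R u v)
certifies? R u v = map′ (uncurry certified) (λ c → isBisimulation c , contains c)
  (isBisimulation? R ×-dec ((reduce u , reduce v) ∈? R))
  where open Certifies

Bisimilar : Word → Word → Set
Bisimilar u v = Certifies (candidate u v) u v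

-- The candidate is passed as an argument so that the type checker evaluates it only once.
bisimilar? : ∀ u v → Dec (Bisimilar u v)
bisimilar? u v = certifies? (candidate u v) u v

Bisimilar⇒≗ : ∀ {u v} → Bisimilar u v → evalWord u ≗ evalWord v
Bisimilar⇒≗ {u} {v} (certified B uv∈B) = begin
  evalWord u          ≈⟨ ≗-sym (evalWord-reduce u) ⟩
  evalWord (reduce u) ≈⟨ bisimulation-sound B uv∈B ⟩
  evalWord (reduce v) ≈⟨ evalWord-reduce v ⟩
  evalWord v          ∎

-- The subgroup V = ⟨c, a₂ca₂⁻¹⟩ and its image P = {(v, v⁻¹)}

cWord : Bool → Word
cWord false = A₂ ∷ A₃⁻ ∷ []
cWord true  = wordInverse (A₂ ∷ A₃⁻ ∷ [])

evalWord-cWord : ∀ s → evalWord (cWord s) ≗ cpow s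
evalWord-cWord false = ·-cong (λ _ → refl) evalWord-[ A₃⁻ ]
evalWord-cWord true  = ≗-trans (evalWord-wordInverse (cWord false)) (inv-cong (evalWord-cWord false))

conjWord : Word → Word → Word
conjWord g u = g ++ u ++ wordInverse g

evalWord-conjWord : ∀ g u → evalWord (conjWord g u) ≗ conj (evalWord g) (evalWord u)
evalWord-conjWord g u = begin
  evalWord (g ++ u ++ wordInverse g)                       ≈⟨ evalWord-++ g (u ++ wordInverse g) ⟩
  evalWord g · evalWord (u ++ wordInverse g)               ≈⟨ ·-cong (λ _ → refl) (evalWord-++ u (wordInverse g)) ⟩
  evalWord g · (evalWord u · evalWord (wordInverse g))     ≈⟨ ≗-sym (·-assoc (evalWord g) (evalWord u) _) ⟩
  (evalWord g · evalWord u) · evalWord (wordInverse g)     ≈⟨ ·-cong (λ _ → refl) (evalWord-wordInverse g) ⟩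
  conj (evalWord g) (evalWord u)                           ∎

VLetter : Set
VLetter = Fin 2 × Bool

VLetter-exhaustible : Exhaustible VLetter
VLetter-exhaustible = ×-exhaustible all? Bool-exhaustible

a₂^ : Fin 2 → Word
a₂^ k = replicate (toℕ k) A₂

vletterWord : VLetter → Word
vletterWord (k , s) = conjWord (a₂^ k) (cWord s)

vletter : VLetter → Aut
vletter m = evalWord (vletterWord m)

vletter≗conj : ∀ k s → vletter (k , s) ≗ conj (evalWord (a₂^ k)) (cpow s)
vletter≗conj k s = ≗-trans (evalWord-conjWord (a₂^ k) (cWord s)) (conj-congʳ (evalWord-cWord s))

VWord : Set
VWord = List VLetter

vword : VWord → Word
vword = concatMap vletterWord

⟦_⟧ⱽ : VWord → Aut
⟦ v ⟧ⱽ = evalWord (vword v)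

⟦∷⟧ⱽ : ∀ m v → ⟦ m ∷ v ⟧ⱽ ≗ vletter m · ⟦ v ⟧ⱽ
⟦∷⟧ⱽ m v = evalWord-++ (vletterWord m) (vword v)

-- Facts certified by evaluation are opaque, so that later proofs never re-run the computation.
opaque
  vletters-commute : ∀ m m′ → Bisimilar (vletterWord m ++ vletterWord m′) (vletterWord m′ ++ vletterWord m)
  vletters-commute = from-yes (VLetter-exhaustible λ m → VLetter-exhaustible λ m′ →
    bisimilar? (vletterWord m ++ vletterWord m′) (vletterWord m′ ++ vletterWord m))

vletter-commutes : ∀ m v → vletter m · ⟦ v ⟧ⱽ ≗ ⟦ v ⟧ⱽ · vletter m
vletter-commutes m []       = ≗-trans (·-identityʳ (vletter m)) (≗-sym (·-identityˡ (vletter m)))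
vletter-commutes m (m′ ∷ v) = begin
  ℓ · ⟦ m′ ∷ v ⟧ⱽ          ≈⟨ ·-cong (λ _ → refl) (⟦∷⟧ⱽ m′ v) ⟩
  ℓ · (ℓ′ · ⟦ v ⟧ⱽ)        ≈⟨ commute-· ℓℓ′≗ℓ′ℓ (vletter-commutes m v) ⟩
  (ℓ′ · ⟦ v ⟧ⱽ) · ℓ        ≈⟨ ·-cong (≗-sym (⟦∷⟧ⱽ m′ v)) (λ _ → refl) ⟩
  ⟦ m′ ∷ v ⟧ⱽ · ℓ          ∎
  where
  ℓ  = vletter m
  ℓ′ = vletter m′
  ℓℓ′≗ℓ′ℓ : ℓ · ℓ′ ≗ ℓ′ · ℓ
  ℓℓ′≗ℓ′ℓ = ≗-trans (≗-sym (evalWord-++ (vletterWord m) (vletterWord m′)))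
              (≗-trans (Bisimilar⇒≗ (vletters-commute m m′)) (evalWord-++ (vletterWord m′) (vletterWord m)))

pairGeneratorWord : Fin 2 → Word
pairGeneratorWord zero       = A₃ ∷ A₂ ∷ A₁ ∷ []
pairGeneratorWord (suc zero) = A₃⁻ ∷ A₁ ∷ A₂⁻ ∷ []

pairLetterWord : VLetter → Word
pairLetterWord (k , false) = pairGeneratorWord k
pairLetterWord (k , true)  = wordInverse (pairGeneratorWord k)

pairWord : VWord → Word
pairWord = concatMap pairLetterWord

opaque
  pairLetterWord-sections : ∀ m →
    root (evalWord (pairLetterWord m)) ≡ false ×
    Bisimilar (section (pairLetterWord m) false) (vletterWord m) ×
    Bisimilar (section (pairLetterWord m) true) (wordInverse (vletterWord m))
  pairLetterWord-sections = from-yes (VLetter-exhaustible λ m →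
    (root (evalWord (pairLetterWord m)) Bool.≟ false) ×-dec
    bisimilar? (section (pairLetterWord m) false) (vletterWord m) ×-dec
    bisimilar? (section (pairLetterWord m) true) (wordInverse (vletterWord m)))

pairLetterWord-pair : ∀ m → evalWord (pairLetterWord m) ≗ pair (vletter m) (inv (vletter m))
pairLetterWord-pair m = begin
  evalWord u                                            ≈⟨ ≗-pair-sec root≡false ⟩
  pair (sec (evalWord u) false) (sec (evalWord u) true) ≈⟨ pair-cong
    (≗-trans (sec-evalWord u false) (Bisimilar⇒≗ left))
    (≗-trans (sec-evalWord u true) (≗-trans (Bisimilar⇒≗ right) (evalWord-wordInverse (vletterWord m)))) ⟩
  pair (vletter m) (inv (vletter m))                    ∎
  where
  u = pairLetterWord m
  root≡false = proj₁ (pairLetterWord-sections m)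
  left       = proj₁ (proj₂ (pairLetterWord-sections m))
  right      = proj₂ (proj₂ (pairLetterWord-sections m))

pairWord-pair : ∀ v → evalWord (pairWord v) ≗ pair ⟦ v ⟧ⱽ (inv ⟦ v ⟧ⱽ)
pairWord-pair []      = e≗pair-e
pairWord-pair (m ∷ v) = begin
  evalWord (pairLetterWord m ++ pairWord v)             ≈⟨ evalWord-++ (pairLetterWord m) (pairWord v) ⟩
  evalWord (pairLetterWord m) · evalWord (pairWord v)   ≈⟨ ·-cong (pairLetterWord-pair m) (pairWord-pair v) ⟩
  pair ℓ (inv ℓ) · pair ⟦ v ⟧ⱽ (inv ⟦ v ⟧ⱽ)              ≈⟨ pair-diagonal-· (vletter-commutes m v) ⟩
  pair (ℓ · ⟦ v ⟧ⱽ) (inv (ℓ · ⟦ v ⟧ⱽ))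
    ≈⟨ pair-cong (≗-sym (⟦∷⟧ⱽ m v)) (inv-cong (≗-sym (⟦∷⟧ⱽ m v))) ⟩
  pair ⟦ m ∷ v ⟧ⱽ (inv ⟦ m ∷ v ⟧ⱽ)                       ∎
  where ℓ = vletter m

-- a₁ inverts V, while a₂ and a₃ both rotate it: c ↦ a₂ca₂⁻¹ ↦ c⁻¹.
rotate : Letter → VLetter → VLetter
rotate (zero , _)  (k , s)        = k , not s
rotate (suc _ , t) (zero , s)     = suc zero , s xor t
rotate (suc _ , t) (suc zero , s) = zero , not (s xor t)

opaque
  conj-letter-vletter : ∀ l m → Bisimilar (conjWord (l ∷ []) (vletterWord m)) (vletterWord (rotate l m))
  conj-letter-vletter = from-yes (Letter-exhaustible λ l → VLetter-exhaustible λ m →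
    bisimilar? (conjWord (l ∷ []) (vletterWord m)) (vletterWord (rotate l m)))

conj-sgen-vletter : ∀ l m → conj (sgen l) (vletter m) ≗ vletter (rotate l m)
conj-sgen-vletter l m = begin
  conj (sgen l) (vletter m)                      ≈⟨ conj-congˡ (≗-sym evalWord-[ l ]) ⟩
  conj (evalWord (l ∷ [])) (vletter m)           ≈⟨ ≗-sym (evalWord-conjWord (l ∷ []) (vletterWord m)) ⟩
  evalWord (conjWord (l ∷ []) (vletterWord m))   ≈⟨ Bisimilar⇒≗ (conj-letter-vletter l m) ⟩
  vletter (rotate l m)                           ∎

rotateBy : Word → VLetter → VLetter
rotateBy = foldr (λ l r → rotate l ∘ r) id

conj-vletter : ∀ u m → conj (evalWord u) (vletter m) ≗ vletter (rotateBy u m)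
conj-vletter []      m = conj-identity (vletter m)
conj-vletter (l ∷ u) m = begin
  conj (sgen l · evalWord u) (vletter m)          ≈⟨ conj-· (sgen l) (evalWord u) (vletter m) ⟩
  conj (sgen l) (conj (evalWord u) (vletter m))   ≈⟨ conj-congʳ (conj-vletter u m) ⟩
  conj (sgen l) (vletter (rotateBy u m))          ≈⟨ conj-sgen-vletter l (rotateBy u m) ⟩
  vletter (rotateBy (l ∷ u) m)                    ∎

V⊆NC : ∀ v → ∃[ p ] InNC p × ⟦ v ⟧ⱽ ≗ p
V⊆NC []            = e , nc-e , λ _ → refl
V⊆NC ((k , s) ∷ v) with V⊆NC v
... | p , p∈NC , v≗p =
  conj (evalWord (a₂^ k)) (cpow s) · p , nc-step (evalWord∈G (a₂^ k)) s p∈NC ,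
  ≗-trans (⟦∷⟧ⱽ (k , s) v) (·-cong (vletter≗conj k s) v≗p)

NC⊆closureV : InNC g → ∀ n → ∃[ v ] Agree n ⟦ v ⟧ⱽ g
NC⊆closureV nc-e                      n = [] , Agree-refl
NC⊆closureV (nc-step {g} g∈G s p∈NC) n with g∈G n | NC⊆closureV p∈NC n
... | u , u≈g | v , v≈p = rotateBy u (zero , s) ∷ v ,
  Agree-trans (≗⇒Agree (⟦∷⟧ⱽ (rotateBy u (zero , s)) v))
    (Agree-· n (Agree-trans (≗⇒Agree conjugate) (Agree-conj n u≈g Agree-refl)) v≈p)
  where
  conjugate : vletter (rotateBy u (zero , s)) ≗ conj (evalWord u) (cpow s)
  conjugate = ≗-trans (≗-sym (conj-vletter u (zero , s)))
                (conj-congʳ (≗-trans (vletter≗conj zero s) (conj-identity (cpow s))))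

-- Cosets of P in Γ

-- (ε , k) stands for c^ε a₂^k; a letter acts on these cosets through its image `weight` in
-- ℤ/2 × ℤ/4.
Coset : Set
Coset = Bool × Fin 4

Coset-exhaustible : Exhaustible Coset
Coset-exhaustible = ×-exhaustible Bool-exhaustible all?

cosetWord : Coset → Word
cosetWord (ε , k) = (if ε then cWord false else []) ++ replicate (toℕ k) A₂

coset : Coset → Aut
coset r = evalWord (cosetWord r)

weight : Letter → Bool × ℕ
weight (zero , _)           = true , 2
weight (suc zero , s)       = false , (if s then 3 else 1)
weight (suc (suc zero) , s) = true , (if s then 3 else 1)

shift : Letter → Coset → Coset
shift l (ε , k) = ε xor proj₁ (weight l) , (toℕ k + proj₂ (weight l)) mod 4

vletters : List VLetter
vletters = cartesianProduct (allFin 2) (false ∷ true ∷ [])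

vwordsUpTo : ℕ → List VWord
vwordsUpTo zero    = [] ∷ []
vwordsUpTo (suc n) = [] ∷ cartesianProductWith _∷_ vletters (vwordsUpTo n)

-- The P-part of each step is found by search among V-words of length at most 2.
opaque
  coset-step : ∀ l r → ∃[ v ] Bisimilar (l ∷ cosetWord r) (cosetWord (shift l r) ++ pairWord v)
  coset-step l r = Any.satisfied (search l r)
    where
    search : ∀ l r → Any (λ v → Bisimilar (l ∷ cosetWord r) (cosetWord (shift l r) ++ pairWord v)) (vwordsUpTo 2)
    search = from-yes (Letter-exhaustible λ l → Coset-exhaustible λ r →
      Any.any? (λ v → bisimilar? (l ∷ cosetWord r) (cosetWord (shift l r) ++ pairWord v)) (vwordsUpTo 2))

normal-form : ∀ u → ∃[ r ] ∃[ v ] evalWord u ≗ evalWord (cosetWord r ++ pairWord v)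
normal-form []      = (false , zero) , [] , λ _ → refl
normal-form (l ∷ u) =
  let r , v , u≗rv = normal-form u
      v′ , step    = coset-step l r
      r′           = shift l r
  in r′ , v′ ++ v , (begin
  sgen l · evalWord u
    ≈⟨ ·-cong (λ _ → refl) u≗rv ⟩
  evalWord ((l ∷ cosetWord r) ++ pairWord v)
    ≈⟨ evalWord-++ (l ∷ cosetWord r) (pairWord v) ⟩
  evalWord (l ∷ cosetWord r) · evalWord (pairWord v)
    ≈⟨ ·-cong (Bisimilar⇒≗ step) (λ _ → refl) ⟩
  evalWord (cosetWord r′ ++ pairWord v′) · evalWord (pairWord v)
    ≈⟨ ≗-sym (evalWord-++ (cosetWord r′ ++ pairWord v′) (pairWord v)) ⟩
  evalWord ((cosetWord r′ ++ pairWord v′) ++ pairWord v)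
    ≡⟨ cong evalWord (trans (List.++-assoc (cosetWord r′) (pairWord v′) (pairWord v))
                            (cong (cosetWord r′ ++_) (sym (List.concatMap-++ pairLetterWord v′ v)))) ⟩
  evalWord (cosetWord r′ ++ pairWord (v′ ++ v)) ∎)

-- Modulo level 2, c and a₂ca₂⁻¹ are commuting involutions, so ⟦ v ⟧ⱽ is determined there by
-- the parities of its two kinds of letters.
toggle : VLetter → Bool × Bool → Bool × Bool
toggle (zero , _)     (p , q) = not p , q
toggle (suc zero , _) (p , q) = p , not q

parityWord : Bool × Bool → VWord
parityWord (p , q) = (if p then (zero , false) ∷ [] else []) ++ (if q then (suc zero , false) ∷ [] else [])

parity : VWord → Bool × Bool
parity = foldr toggle (false , false)

opaque
  toggle-agree : ∀ m q → Agree 2 ⟦ m ∷ parityWord q ⟧ⱽ ⟦ parityWord (toggle m q) ⟧ⱽ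
  toggle-agree = from-yes (VLetter-exhaustible λ m → ×-exhaustible Bool-exhaustible Bool-exhaustible λ q →
    Agree? 2 ⟦ m ∷ parityWord q ⟧ⱽ ⟦ parityWord (toggle m q) ⟧ⱽ)

parity-agree : ∀ v → Agree 2 ⟦ v ⟧ⱽ ⟦ parityWord (parity v) ⟧ⱽ
parity-agree []      = Agree-refl
parity-agree (m ∷ v) =
  Agree-trans (≗⇒Agree (⟦∷⟧ⱽ m v))
  (Agree-trans (Agree-· 2 Agree-refl (parity-agree v))
  (Agree-trans (≗⇒Agree (≗-sym (⟦∷⟧ⱽ m (parityWord (parity v)))))
               (toggle-agree m (parity v))))

opaque
  trivial-or-separated : ∀ r q → r ≡ (false , zero) ⊎
    Separated (coset r · pair ⟦ parityWord q ⟧ⱽ (inv ⟦ parityWord q ⟧ⱽ))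
  trivial-or-separated = from-yes (Coset-exhaustible λ r → ×-exhaustible Bool-exhaustible Bool-exhaustible λ q →
    Product.≡-dec Bool._≟_ Fin._≟_ r (false , zero) ⊎-dec
    separated? (coset r · pair ⟦ parityWord q ⟧ⱽ (inv ⟦ parityWord q ⟧ⱽ)))

-- The two inclusions

pair-approximation⇒V : ∀ n u → Agree (3 + n) (evalWord u) (pair x (inv x)) → ∃[ v ] Agree n ⟦ v ⟧ⱽ x
pair-approximation⇒V {x} n u u≈pair with normal-form u
... | r , v , u≗rv with trivial-or-separated r (parity v)
... | inj₁ refl = v , Agree-mono (m≤n+m n 2) (Agree-sec (Agree-trans (≗⇒Agree (≗-sym u≗pair)) u≈pair) false)
  where
  u≗pair : evalWord u ≗ pair ⟦ v ⟧ⱽ (inv ⟦ v ⟧ⱽ)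
  u≗pair = ≗-trans u≗rv (pairWord-pair v)
... | inj₂ separated =
  ⊥-elim (Separated⇒¬Agree separated (Agree-trans level3 (Agree-mono (m≤m+n 3 n) u≈pair)))
  where
  q = ⟦ parityWord (parity v) ⟧ⱽ
  q≈v : Agree 2 q ⟦ v ⟧ⱽ
  q≈v = Agree-sym (parity-agree v)
  u≗rv′ : evalWord u ≗ coset r · pair ⟦ v ⟧ⱽ (inv ⟦ v ⟧ⱽ)
  u≗rv′ = ≗-trans u≗rv (≗-trans (evalWord-++ (cosetWord r) (pairWord v)) (·-cong (λ _ → refl) (pairWord-pair v)))
  level3 : Agree 3 (coset r · pair q (inv q)) (evalWord u)
  level3 = Agree-trans (Agree-· 3 Agree-refl (Agree-pair q≈v (Agree-inv 2 q≈v))) (≗⇒Agree (≗-sym u≗rv′))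

InU⇒pair∈G : ∀ x → InU x → InG (pair x (inv x))
InU⇒pair∈G x x∈U zero    = [] , λ _ ()
InU⇒pair∈G x x∈U (suc n) with x∈U n
... | p , p∈NC , p≈x with NC⊆closureV p∈NC n
... | v , v≈p = pairWord v ,
  Agree-trans (≗⇒Agree (pairWord-pair v)) (Agree-pair v≈x (Agree-inv n v≈x))
  where v≈x = Agree-trans v≈p p≈x

pair∈G⇒InU : ∀ x → InG (pair x (inv x)) → InU x
pair∈G⇒InU x pair∈G n with pair∈G (3 + n)
... | u , u≈pair with pair-approximation⇒V n u u≈pair
... | v , v≈x with V⊆NC v
... | p , p∈NC , v≗p = p , p∈NC , Agree-trans (≗⇒Agree (≗-sym v≗p)) v≈x

proposition3p15 : (x : Aut) → InU x ⇔ InG (pair x (inv x))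
proposition3p15 x = mk⇔ (InU⇒pair∈G x) (pair∈G⇒InU x)
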